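{- Let $G=(V,E)$ be a graph, $S$ a multiset of vertices of $V$, and $\mathsf{M}=(S,\mathcal{I}_{\mathsf{M}})$ a matroid with rank function $r_{\mathsf{M}}$ such that $S_v\in\mathcal{I}_{\mathsf{M}}$ for every $v\in V$. Let $\mathsf{M}'_{KT}$ be the matroid on $E\cup S$ with rank function $$r'_{KT}(F\cup T)=r_{\mathsf{M}}(S)|V|+\min\Big\{e_F(\mathcal{P})-\sum_{X\in\mathcal{P}}\big(r_{\mathsf{M}}(S)-r_{\mathsf{M}}(T_X)\big):\mathcal{P}\text{ partition of }V\Big\}\quad(F\subseteq E,\ T\subseteq S),$$ and let $\mathsf{M}_{KT}$ be the matroid on $E$ with rank function $$r_{KT}(F)=r_{\mathsf{M}}(S)|V|-|S|+\min\Big\{e_F(\mathcal{P})-\sum_{X\in\mathcal{P}}\big(r_{\mathsf{M}}(S)-r_{\mathsf{M}}(S_X)\big):\mathcal{P}\text{ partition of }V\Big\}\quad(F\subseteq E).$$ Then $S$ is independent in $\mathsf{M}'_{KT}$ and $\mathsf{M}'_{KT}/S=\mathsf{M}_{KT}$.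
   Context: A multiset $S$ of vertices is a finite collection of vertices with multiplicities; for $T\subseteq S$ and $X\subseteq V$, $T_X$ is the set of elements of $T$ located in $X$, and $S_v=S_{\{v\}}$. For $F\subseteq E$ and a partition $\mathcal{P}$ of $V$, $e_F(\mathcal{P})$ is the number of edges of $F$ joining different members of $\mathcal{P}$. The ground set $E\cup S$ is a disjoint union. For an independent set $X$ of a matroid with rank function $r$ on ground set $U$, the contraction by $X$ is the matroid on $U\setminus X$ with rank function $Z\mapsto r(X\cup Z)-|X|$. -}

module Defs where

open import Data.Nat using (ℕ; zero; suc; _+_; _*_; _≤_)
open import Data.Bool using (Bool; true; false; _∧_; not; if_then_else_)
open import Data.Fin using (Fin; zero; suc; _≟_)
open import Data.Fin.Subset using (Subset; _⊆_; _∩_; _∪_; ∣_∣) renaming (⊤ to full; ⊥ to empty)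
open import Data.Vec using (tabulate; lookup)
open import Data.Product using (_×_; proj₁; proj₂)
open import Data.List using (List; []; _∷_; map; concatMap; foldr; allFin)
open import Data.Integer as ℤ using (ℤ; +_; _-_; _⊓_)
open import Relation.Nullary.Decidable using (⌊_⌋)

record Matroid (k : ℕ) : Set where
  field
    rank        : Subset k → ℕ
    rank-bound  : ∀ X → rank X ≤ ∣ X ∣
    rank-mono   : ∀ X Y → X ⊆ Y → rank X ≤ rank Y
    rank-submod : ∀ X Y → rank (X ∪ Y) + rank (X ∩ Y) ≤ rank X + rank Y

Independent : ∀ {k} → Matroid k → Subset k → Set
Independent M X = Matroid.rank M X ≡′ ∣ X ∣
  where open import Relation.Binary.PropositionalEquality renaming (_≡_ to _≡′_)

-- Setting: vertices V = Fin n; edges E = Fin m with endpoints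
-- ends : Fin m → Fin n × Fin n (multigraph, loops allowed);
-- multiset S = Fin k with location map loc : Fin k → Fin n.

located : ∀ {k n} → (Fin k → Fin n) → Subset k → Subset n → Subset k
located loc T X = tabulate (λ j → lookup T j ∧ lookup X (loc j))

atVertex : ∀ {k n} → (Fin k → Fin n) → Fin n → Subset k
atVertex loc v = tabulate (λ j → ⌊ loc j ≟ v ⌋)

-- Partitions of V are represented by labellings p : Fin n → Fin n;
-- the members of the partition are the nonempty fibres of p.
block : ∀ {n} → (Fin n → Fin n) → Fin n → Subset n
block p i = tabulate (λ v → ⌊ p v ≟ i ⌋)

isEmpty : ∀ {n} → Subset n → Bool
isEmpty X with ∣ X ∣
... | zero  = true
... | suc _ = false

crossing : ∀ {m n} → (Fin m → Fin n × Fin n) → Subset m → (Fin n → Fin n) → ℕ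
crossing ends F p =
  ∣ tabulate (λ e → lookup F e ∧ not ⌊ p (proj₁ (ends e)) ≟ p (proj₂ (ends e)) ⌋) ∣

sumFin : ∀ {n} → (Fin n → ℤ) → ℤ
sumFin {zero}  f = + 0
sumFin {suc n} f = f zero ℤ.+ sumFin (λ i → f (suc i))

deficiency : ∀ {k n} → (Fin k → Fin n) → Matroid k → Subset k → (Fin n → Fin n) → ℤ
deficiency loc M T p =
  sumFin (λ i → if isEmpty (block p i) then + 0
                 else (+ Matroid.rank M full - + Matroid.rank M (located loc T (block p i))))

consF : ∀ {n m} → Fin m → (Fin n → Fin m) → Fin (suc n) → Fin m
consF a f zero    = a
consF a f (suc i) = f i

allFuns : ∀ n m → List (Fin n → Fin m)
allFuns zero    m = (λ ()) ∷ []
allFuns (suc n) m = concatMap (λ f → map (λ a → consF a f) (allFin m)) (allFuns n m)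

minWith : ∀ {A : Set} → (A → ℤ) → A → List A → ℤ
minWith g a xs = foldr (λ x acc → g x ⊓ acc) (g a) xs

minPart : ∀ {k m n} → (Fin m → Fin n × Fin n) → (Fin k → Fin n) → Matroid k →
          Subset m → Subset k → ℤ
minPart {n = n} ends loc M F T =
  minWith (λ p → + crossing ends F p - deficiency loc M T p) (λ v → v) (allFuns n n)

rKT′ : ∀ {k m n} → (Fin m → Fin n × Fin n) → (Fin k → Fin n) → Matroid k →
       Subset m → Subset k → ℤ
rKT′ {n = n} ends loc M F T = + (Matroid.rank M full * n) ℤ.+ minPart ends loc M F T

rKT : ∀ {k m n} → (Fin m → Fin n × Fin n) → (Fin k → Fin n) → Matroid k →
      Subset m → ℤ
rKT {k} {n = n} ends loc M F =
  + (Matroid.rank M full * n) - + ∣ full {k} ∣ ℤ.+ minPart ends loc M F full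

-- rank function of the contraction M'_KT / S on E:  Z ↦ r'(S ∪ Z) − |S|
rKT′/S : ∀ {k m n} → (Fin m → Fin n × Fin n) → (Fin k → Fin n) → Matroid k →
         Subset m → ℤ
rKT′/S {k} ends loc M F = rKT′ ends loc M F full - + ∣ full {k} ∣

{-# OPTIONS --safe #-}
-- The contraction identity is bookkeeping: both sides are r(S)|V| − |S| plus the same
-- minimum.  For the independence of S take F = ∅, so that no edge crosses and the minimum
-- is minus the largest deficiency Σ_{X∈P} (r(S) − r(S_X)).  Because each S_v is
-- independent, r(S_X) ≥ r(S_v) = |S_v| for every v ∈ X, so a block contributes at most the
-- total slack Σ_{v∈X} (r(S) − |S_v|) of its vertices.  Hence the discrete partition is
-- optimal, with deficiency Σ_v (r(S) − |S_v|) = r(S)|V| − |S|.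
module Submission where

open import Defs
open import Data.Nat.Base as ℕ using (ℕ; zero; suc)
import Data.Nat.Properties as ℕ
open import Data.Bool.Base using (Bool; true; false; _∧_; not; if_then_else_)
open import Data.Bool.Properties using (T-≡)
open import Data.Fin using (Fin; zero; suc; _≟_)
open import Data.Fin.Subset using (Subset; ∣_∣; _⊆_; _∈_; ⁅_⁆; Empty; Nonempty)
  renaming (⊤ to full; ⊥ to empty)
open import Data.Fin.Subset.Properties
  using (⊆⊤; ∣⊤∣≡n; ∣⊥∣≡0; Empty-unique; nonempty?; x∈⁅y⁆⇒x≡y; ∣⁅x⁆∣≡1; p⊆q⇒∣p∣≤∣q∣)
open import Data.Vec.Base using (tabulate; lookup)
open import Data.Vec.Properties
  using (lookup∘tabulate; lookup-replicate; tabulate-cong; []=⇒lookup; lookup⇒[]=)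
open import Data.Product.Base using (_×_; _,_; proj₁; proj₂)
open import Data.List.Base using (List; []; _∷_)
open import Data.Integer.Base as ℤ using (ℤ; +_; _+_; _-_; -_; _≤_; _⊓_; +≤+)
import Data.Integer.Properties as ℤ
open import Data.Integer.Tactic.RingSolver using (solve-∀)
open import Algebra.Properties.CommutativeMonoid.Sum ℤ.+-0-commutativeMonoid
  using (sum; sum-syntax; sum-cong-≗; sum-replicate-zero; ∑-distrib-+; ∑-comm)
open import Function.Base using (_∘_; id)
open import Function.Bundles using (Equivalence)
open import Relation.Nullary.Decidable using (yes; no; ⌊_⌋; isYes≗does; toWitness; fromWitness)
open import Relation.Binary.PropositionalEquality
  using (_≡_; refl; sym; trans; cong; cong₂; subst; subst₂; module ≡-Reasoning)

⌊≟⌋⇒≡ : ∀ {n} {a b : Fin n} → ⌊ a ≟ b ⌋ ≡ true → a ≡ b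
⌊≟⌋⇒≡ = toWitness ∘ Equivalence.from T-≡

≡⇒⌊≟⌋ : ∀ {n} {a b : Fin n} → a ≡ b → ⌊ a ≟ b ⌋ ≡ true
≡⇒⌊≟⌋ = Equivalence.to T-≡ ∘ fromWitness

⌊suc≟suc⌋ : ∀ {n} (a b : Fin n) → ⌊ suc a ≟ suc b ⌋ ≡ ⌊ a ≟ b ⌋
⌊suc≟suc⌋ a b = trans (isYes≗does (suc a ≟ suc b)) (sym (isYes≗does (a ≟ b)))

sumFin≡sum : ∀ {n} (f : Fin n → ℤ) → sumFin f ≡ sum f
sumFin≡sum {zero}  f = refl
sumFin≡sum {suc n} f = cong (_+_ (f zero)) (sumFin≡sum (f ∘ suc))

∑-mono-≤ : ∀ {n} {f g : Fin n → ℤ} → (∀ i → f i ≤ g i) → sum f ≤ sum g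
∑-mono-≤ {zero}  f≤g = ℤ.≤-refl
∑-mono-≤ {suc n} f≤g = ℤ.+-mono-≤ (f≤g zero) (∑-mono-≤ (f≤g ∘ suc))

∑-nonneg : ∀ {n} {f : Fin n → ℤ} → (∀ i → + 0 ≤ f i) → + 0 ≤ sum f
∑-nonneg {n} {f} 0≤f = subst (_≤ sum f) (sum-replicate-zero n) (∑-mono-≤ 0≤f)

term≤∑ : ∀ {n} {f : Fin n → ℤ} → (∀ i → + 0 ≤ f i) → ∀ j → f j ≤ sum f
term≤∑ {f = f} 0≤f zero =
  subst (_≤ sum f) (ℤ.+-identityʳ (f zero)) (ℤ.+-monoʳ-≤ (f zero) (∑-nonneg (0≤f ∘ suc)))
term≤∑ {f = f} 0≤f (suc j) =
  ℤ.≤-trans (term≤∑ (0≤f ∘ suc) j)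
    (subst (_≤ sum f) (ℤ.+-identityˡ _) (ℤ.+-monoˡ-≤ (sum (f ∘ suc)) (0≤f zero)))

∑-const : ∀ n c → ∑[ i < n ] (+ c) ≡ + (n ℕ.* c)
∑-const zero    c = refl
∑-const (suc n) c = cong (_+_ (+ c)) (∑-const n c)

∑-δ : ∀ {n} (a : Fin n) (x : ℤ) → ∑[ i < n ] (if ⌊ a ≟ i ⌋ then x else + 0) ≡ x
∑-δ {suc n} zero    x = trans (cong (_+_ x) (sum-replicate-zero n)) (ℤ.+-identityʳ x)
∑-δ {suc n} (suc a) x = begin
  + 0 + ∑[ i < n ] (if ⌊ suc a ≟ suc i ⌋ then x else + 0) ≡⟨ ℤ.+-identityˡ _ ⟩
  ∑[ i < n ] (if ⌊ suc a ≟ suc i ⌋ then x else + 0)       ≡⟨ sum-cong-≗ (cong (if_then x else + 0) ∘ ⌊suc≟suc⌋ a) ⟩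
  ∑[ i < n ] (if ⌊ a ≟ i ⌋ then x else + 0)               ≡⟨ ∑-δ a x ⟩
  x                                                       ∎
  where open ≡-Reasoning

∑-fibres : ∀ {m n} (f : Fin m → Fin n) (w : Fin m → ℤ) →
           sum w ≡ ∑[ i < n ] ∑[ v < m ] (if ⌊ f v ≟ i ⌋ then w v else + 0)
∑-fibres f w = trans (sum-cong-≗ (λ v → sym (∑-δ (f v) (w v))))
                     (∑-comm (λ v i → if ⌊ f v ≟ i ⌋ then w v else + 0))

∈tabulate⁺ : ∀ {n} {f : Fin n → Bool} {j} → f j ≡ true → j ∈ tabulate f
∈tabulate⁺ {f = f} {j} fj = lookup⇒[]= j (tabulate f) (trans (lookup∘tabulate f j) fj)

∈tabulate⁻ : ∀ {n} {f : Fin n → Bool} {j} → j ∈ tabulate f → f j ≡ true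
∈tabulate⁻ {f = f} {j} j∈ = trans (sym (lookup∘tabulate f j)) ([]=⇒lookup j∈)

∣tabulate∣≡∑ : ∀ {n} (f : Fin n → Bool) →
               + ∣ tabulate f ∣ ≡ ∑[ j < n ] (if f j then + 1 else + 0)
∣tabulate∣≡∑ {zero}  f = refl
∣tabulate∣≡∑ {suc n} f with f zero
... | true  = cong (_+_ (+ 1)) (∣tabulate∣≡∑ (f ∘ suc))
... | false = trans (∣tabulate∣≡∑ (f ∘ suc)) (sym (ℤ.+-identityˡ _))

∣tabulate∣≡0 : ∀ {n} (f : Fin n → Bool) → (∀ j → f j ≡ false) → ∣ tabulate f ∣ ≡ 0
∣tabulate∣≡0 {zero}  f f≡false = refl
∣tabulate∣≡0 {suc n} f f≡false rewrite f≡false zero = ∣tabulate∣≡0 (f ∘ suc) (f≡false ∘ suc)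

isEmpty-∣∣≡0 : ∀ {n} (X : Subset n) → ∣ X ∣ ≡ 0 → isEmpty X ≡ true
isEmpty-∣∣≡0 X ∣X∣≡0 with ∣ X ∣ | ∣X∣≡0
... | zero | refl = refl

isEmpty-1≤∣∣ : ∀ {n} (X : Subset n) → 1 ℕ.≤ ∣ X ∣ → isEmpty X ≡ false
isEmpty-1≤∣∣ X 1≤∣X∣ with ∣ X ∣ | 1≤∣X∣
... | suc _ | _ = refl

isEmpty-Empty : ∀ {n} {X : Subset n} → Empty X → isEmpty X ≡ true
isEmpty-Empty {n} {X} X-empty =
  isEmpty-∣∣≡0 X (trans (cong ∣_∣ (Empty-unique X-empty)) (∣⊥∣≡0 n))

isEmpty-Nonempty : ∀ {n} {X : Subset n} → Nonempty X → isEmpty X ≡ false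
isEmpty-Nonempty {X = X} (x , x∈X) = isEmpty-1≤∣∣ X
  (subst (ℕ._≤ ∣ X ∣) (∣⁅x⁆∣≡1 x) (p⊆q⇒∣p∣≤∣q∣ ⁅x⁆⊆X))
  where
  ⁅x⁆⊆X : ⁅ x ⁆ ⊆ X
  ⁅x⁆⊆X y∈⁅x⁆ = subst (_∈ X) (sym (x∈⁅y⁆⇒x≡y x y∈⁅x⁆)) x∈X

minWith-lowerBound : ∀ {A : Set} (g : A → ℤ) a (xs : List A) →
                     (∀ x → g a ≤ g x) → minWith g a xs ≡ g a
minWith-lowerBound g a []       _     = refl
minWith-lowerBound g a (x ∷ xs) ga≤gx =
  trans (cong (g x ⊓_) (minWith-lowerBound g a xs ga≤gx)) (ℤ.i≥j⇒i⊓j≡j (ga≤gx x))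

crossing-empty : ∀ {m n} (ends : Fin m → Fin n × Fin n) p → crossing ends empty p ≡ 0
crossing-empty {m} ends p = ∣tabulate∣≡0 crosses (λ e → cong (_∧ _) (lookup-replicate e false))
  where
  crosses : Fin m → Bool
  crosses e = lookup empty e ∧ not ⌊ p (proj₁ (ends e)) ≟ p (proj₂ (ends e)) ⌋

∑∣atVertex∣ : ∀ {k n} (loc : Fin k → Fin n) → ∑[ v < n ] (+ ∣ atVertex loc v ∣) ≡ + k
∑∣atVertex∣ {k} {n} loc = begin
  ∑[ v < n ] (+ ∣ atVertex loc v ∣)                           ≡⟨ sum-cong-≗ count-atVertex ⟩
  ∑[ v < n ] ∑[ j < k ] (if ⌊ loc j ≟ v ⌋ then + 1 else + 0) ≡⟨ ∑-fibres loc (λ _ → + 1) ⟨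
  ∑[ j < k ] (+ 1)                                            ≡⟨ ∑-const k 1 ⟩
  + (k ℕ.* 1)                                                 ≡⟨ cong +_ (ℕ.*-identityʳ k) ⟩
  + k                                                         ∎
  where
  open ≡-Reasoning
  count-atVertex : ∀ v → + ∣ atVertex loc v ∣ ≡ ∑[ j < k ] (if ⌊ loc j ≟ v ⌋ then + 1 else + 0)
  count-atVertex v = ∣tabulate∣≡∑ (λ j → ⌊ loc j ≟ v ⌋)

module _ {n k : ℕ} (loc : Fin k → Fin n) (M : Matroid k)
         (atVertex-independent : ∀ v → Independent M (atVertex loc v)) where
  open Matroid M

  slack : Fin n → ℤ
  slack v = + rank full - + ∣ atVertex loc v ∣

  ∣atVertex∣≤rank : ∀ {v X} → atVertex loc v ⊆ X → ∣ atVertex loc v ∣ ℕ.≤ rank X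
  ∣atVertex∣≤rank {v} {X} Sᵥ⊆X =
    subst (ℕ._≤ rank X) (atVertex-independent v) (rank-mono _ X Sᵥ⊆X)

  slack-nonneg : ∀ v → + 0 ≤ slack v
  slack-nonneg v = ℤ.i≤j⇒0≤j-i (+≤+ (∣atVertex∣≤rank ⊆⊤))

  atVertex⊆located : ∀ (p : Fin n → Fin n) v → atVertex loc v ⊆ located loc full (block p (p v))
  atVertex⊆located p v {j} j∈Sᵥ = ∈tabulate⁺ (cong₂ _∧_ (lookup-replicate j true)
    (trans (lookup∘tabulate (λ u → ⌊ p u ≟ p v ⌋) (loc j)) (≡⇒⌊≟⌋ (cong p locj≡v))))
    where
    locj≡v : loc j ≡ v
    locj≡v = ⌊≟⌋⇒≡ (∈tabulate⁻ {f = λ j → ⌊ loc j ≟ v ⌋} j∈Sᵥ)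

  blockDeficiency : (Fin n → Fin n) → Fin n → ℤ
  blockDeficiency p i = if isEmpty (block p i) then + 0
                        else (+ rank full - + rank (located loc full (block p i)))

  fibreTerm : (Fin n → Fin n) → Fin n → Fin n → ℤ
  fibreTerm p i v = if ⌊ p v ≟ i ⌋ then slack v else + 0

  fibreTerm-nonneg : ∀ p i v → + 0 ≤ fibreTerm p i v
  fibreTerm-nonneg p i v with ⌊ p v ≟ i ⌋
  ... | true  = slack-nonneg v
  ... | false = ℤ.≤-refl

  fibreTerm-diagonal : ∀ p v → fibreTerm p (p v) v ≡ slack v
  fibreTerm-diagonal p v = cong (if_then slack v else + 0) (≡⇒⌊≟⌋ {a = p v} refl)

  blockDeficiency≤slack : ∀ p v → blockDeficiency p (p v) ≤ slack v
  blockDeficiency≤slack p v with isEmpty (block p (p v))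
  ... | true  = slack-nonneg v
  ... | false = ℤ.+-monoʳ-≤ (+ rank full)
                  (ℤ.neg-mono-≤ (+≤+ (∣atVertex∣≤rank (atVertex⊆located p v))))

  blockDeficiency≤∑fibreTerm : ∀ p i → blockDeficiency p i ≤ sum (fibreTerm p i)
  blockDeficiency≤∑fibreTerm p i with nonempty? (block p i)
  ... | yes (v , v∈block) with ⌊≟⌋⇒≡ (∈tabulate⁻ {f = λ u → ⌊ p u ≟ i ⌋} v∈block)
  ...   | refl = ℤ.≤-trans (blockDeficiency≤slack p v)
                   (subst (_≤ sum (fibreTerm p (p v))) (fibreTerm-diagonal p v)
                     (term≤∑ (fibreTerm-nonneg p (p v)) v))
  blockDeficiency≤∑fibreTerm p i | no block-empty
    rewrite isEmpty-Empty block-empty = ∑-nonneg (fibreTerm-nonneg p i)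

  deficiency≤∑slack : ∀ p → deficiency loc M full p ≤ sum slack
  deficiency≤∑slack p = begin
    deficiency loc M full p         ≡⟨ sumFin≡sum (blockDeficiency p) ⟩
    sum (blockDeficiency p)         ≤⟨ ∑-mono-≤ (blockDeficiency≤∑fibreTerm p) ⟩
    ∑[ i < n ] sum (fibreTerm p i)  ≡⟨ ∑-fibres p slack ⟨
    sum slack                       ∎
    where open ℤ.≤-Reasoning

  located-discrete : ∀ v → located loc full (block id v) ≡ atVertex loc v
  located-discrete v = tabulate-cong λ j →
    cong₂ _∧_ (lookup-replicate j true) (lookup∘tabulate (λ u → ⌊ u ≟ v ⌋) (loc j))

  blockDeficiency-discrete : ∀ v → blockDeficiency id v ≡ slack v
  blockDeficiency-discrete v
    rewrite isEmpty-Nonempty (v , ∈tabulate⁺ {f = λ u → ⌊ u ≟ v ⌋} (≡⇒⌊≟⌋ refl))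
          | located-discrete v
          | atVertex-independent v
    = refl

  deficiency-discrete : deficiency loc M full id ≡ sum slack
  deficiency-discrete =
    trans (sumFin≡sum (blockDeficiency id)) (sum-cong-≗ blockDeficiency-discrete)

  ∑slack+k≡n*rank : sum slack + + k ≡ + (n ℕ.* rank full)
  ∑slack+k≡n*rank = begin
    sum slack + + k                               ≡⟨ cong (_+_ (sum slack)) (∑∣atVertex∣ loc) ⟨
    sum slack + ∑[ v < n ] (+ ∣ atVertex loc v ∣) ≡⟨ ∑-distrib-+ slack _ ⟨
    ∑[ v < n ] (slack v + + ∣ atVertex loc v ∣)   ≡⟨ sum-cong-≗ slack+∣atVertex∣ ⟩
    ∑[ v < n ] (+ rank full)                      ≡⟨ ∑-const n (rank full) ⟩
    + (n ℕ.* rank full)                           ∎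
    where
    open ≡-Reasoning
    i-j+j≡i : ∀ i j → i - j + j ≡ i
    i-j+j≡i = solve-∀
    slack+∣atVertex∣ : ∀ v → slack v + + ∣ atVertex loc v ∣ ≡ + rank full
    slack+∣atVertex∣ v = i-j+j≡i (+ rank full) (+ ∣ atVertex loc v ∣)

  minPart-noEdges : ∀ {m} (ends : Fin m → Fin n × Fin n) →
                    minPart ends loc M empty full ≡ - sum slack
  minPart-noEdges ends = begin
    minWith objective id (allFuns n n) ≡⟨ minWith-lowerBound objective id (allFuns n n) discrete-minimal ⟩
    objective id                       ≡⟨ objective≡-deficiency id ⟩
    - deficiency loc M full id         ≡⟨ cong -_ deficiency-discrete ⟩
    - sum slack                        ∎
    where
    open ≡-Reasoning
    objective : (Fin n → Fin n) → ℤ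
    objective p = + crossing ends empty p - deficiency loc M full p
    objective≡-deficiency : ∀ p → objective p ≡ - deficiency loc M full p
    objective≡-deficiency p =
      trans (cong (λ c → + c - deficiency loc M full p) (crossing-empty ends p)) (ℤ.+-identityˡ _)
    discrete-minimal : ∀ p → objective id ≤ objective p
    discrete-minimal p = subst₂ _≤_ (sym (objective≡-deficiency id)) (sym (objective≡-deficiency p))
      (ℤ.neg-mono-≤ (subst (deficiency loc M full p ≤_) (sym deficiency-discrete)
                      (deficiency≤∑slack p)))

  rKT′-S≡∣S∣ : ∀ {m} (ends : Fin m → Fin n × Fin n) →
               rKT′ ends loc M empty full ≡ + ∣ full {k} ∣
  rKT′-S≡∣S∣ ends = begin
    + (rank full ℕ.* n) + minPart ends loc M empty full ≡⟨ cong (_+_ (+ (rank full ℕ.* n))) (minPart-noEdges ends) ⟩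
    + (rank full ℕ.* n) - sum slack                     ≡⟨ cong (λ a → + a - sum slack) (ℕ.*-comm _ n) ⟩
    + (n ℕ.* rank full) - sum slack                     ≡⟨ cong (_- sum slack) ∑slack+k≡n*rank ⟨
    sum slack + + k - sum slack                         ≡⟨ i+j-i≡j (sum slack) (+ k) ⟩
    + k                                                 ≡⟨ cong +_ (∣⊤∣≡n k) ⟨
    + ∣ full {k} ∣                                      ∎
    where
    open ≡-Reasoning
    i+j-i≡j : ∀ i j → i + j - i ≡ j
    i+j-i≡j = solve-∀

rKT′/S≡rKT : ∀ {k m n} (ends : Fin m → Fin n × Fin n) (loc : Fin k → Fin n) (M : Matroid k) F →
             rKT′/S ends loc M F ≡ rKT ends loc M F
rKT′/S≡rKT {k} {n = n} ends loc M F =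
  a+b-c≡a-c+b (+ (Matroid.rank M full ℕ.* n)) (minPart ends loc M F full) (+ ∣ full {k} ∣)
  where
  a+b-c≡a-c+b : ∀ a b c → a + b - c ≡ a - c + b
  a+b-c≡a-c+b = solve-∀

claim6 : ∀ {n m k : ℕ} (ends : Fin m → Fin n × Fin n) (loc : Fin k → Fin n)
           (M : Matroid k) →
           (∀ v → Independent M (atVertex loc v)) →
           (rKT′ ends loc M empty full ≡ + ∣ full {k} ∣)
           × (∀ (F : Subset m) → rKT′/S ends loc M F ≡ rKT ends loc M F)
claim6 ends loc M atVertex-independent =
  rKT′-S≡∣S∣ loc M atVertex-independent ends , rKT′/S≡rKT ends loc M
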